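{- For every integer $d \geq 1$, $$P_d(X,Y) = -f_d(Y,X,1),$$ where $$P_d(X,Y) = d \sum_{\substack{k,l \geq 0 \\ 0 \leq 2k+3l \leq d}} (-1)^{k-1}\binom{k+l}{k}\binom{d-k-2l}{k+l}\frac{X^k Y^{d-2k-3l}}{d-k-2l},$$ and $f_d \in \mathbb{Z}[\sigma_1,\sigma_2,\sigma_3]$ is the unique polynomial such that $$x_1^d + x_2^d + x_3^d = f_d(\sigma_1,\sigma_2,\sigma_3)$$ with $\sigma_1 = x_1+x_2+x_3$, $\sigma_2 = x_1x_2+x_2x_3+x_3x_1$, $\sigma_3 = x_1x_2x_3$ the elementary symmetric polynomials in three variables.
   Context: $f_d$ expresses the $d$-th power sum of three variables in terms of the elementary symmetric polynomials; e.g. $f_1 = \sigma_1$, $f_2 = \sigma_1^2 - 2\sigma_2$, $f_3 = \sigma_1^3 - 3\sigma_1\sigma_2 + 3\sigma_3$, and for $d > 3$ one has $f_d = \sigma_1 f_{d-1} - \sigma_2 f_{d-2} + \sigma_3 f_{d-3}$ (Newton identities). -}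

module Defs where

open import Level using (0ℓ)
open import Data.Bool using (Bool; true; false; if_then_else_; _∧_)
open import Data.Nat as ℕ using (ℕ; zero; suc; _∸_; _≡ᵇ_; _≤ᵇ_)
open import Data.Nat.Combinatorics using (_C_)
open import Data.Integer as ℤ using (ℤ; +_)
open import Data.Rational as ℚ using (ℚ; 0ℚ; 1ℚ)
open import Algebra.Bundles.Raw using (RawRing)
open import Relation.Binary.PropositionalEquality using (_≡_)

-- f_d, via the Newton identities, as a polynomial expression in
-- (σ₁, σ₂, σ₃) that can be evaluated in any (raw) ring.
-- f 0 = 3 (= x₁⁰ + x₂⁰ + x₃⁰), f 1 = σ₁, f 2 = σ₁² - 2σ₂,
-- f 3 = σ₁³ - 3σ₁σ₂ + 3σ₃, f d = σ₁ f(d-1) - σ₂ f(d-2) + σ₃ f(d-3).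

module _ (R : RawRing 0ℓ 0ℓ) where
  open RawRing R

  f : ℕ → Carrier → Carrier → Carrier → Carrier
  f zero s₁ s₂ s₃ = 1# + 1# + 1#
  f (suc zero) s₁ s₂ s₃ = s₁
  f (suc (suc zero)) s₁ s₂ s₃ = s₁ * s₁ + - (s₂ + s₂)
  f (suc (suc (suc zero))) s₁ s₂ s₃ =
    s₁ * s₁ * s₁ + - (s₁ * s₂ + s₁ * s₂ + s₁ * s₂) + (s₃ + s₃ + s₃)
  f (suc (suc (suc (suc n)))) s₁ s₂ s₃ =
    s₁ * f (suc (suc (suc n))) s₁ s₂ s₃
    + - (s₂ * f (suc (suc n)) s₁ s₂ s₃)
    + s₃ * f (suc n) s₁ s₂ s₃

-- ℚ[X,Y]: a polynomial is its coefficient function,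
-- p i j = coefficient of X^i Y^j.

Poly2 : Set
Poly2 = ℕ → ℕ → ℚ

sumTo : ℕ → (ℕ → ℚ) → ℚ
sumTo zero    g = g zero
sumTo (suc n) g = sumTo n g ℚ.+ g (suc n)

_+ₚ_ : Poly2 → Poly2 → Poly2
(p +ₚ q) i j = p i j ℚ.+ q i j

-ₚ_ : Poly2 → Poly2
(-ₚ p) i j = ℚ.- p i j

_*ₚ_ : Poly2 → Poly2 → Poly2
(p *ₚ q) i j = sumTo i λ a → sumTo j λ b → p a b ℚ.* q (i ∸ a) (j ∸ b)

mono : ℚ → ℕ → ℕ → Poly2
mono c k m i j = if (i ≡ᵇ k) ∧ (j ≡ᵇ m) then c else 0ℚ

0ₚ 1ₚ Xₚ Yₚ : Poly2
0ₚ _ _ = 0ℚ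
1ₚ = mono 1ℚ 0 0
Xₚ = mono 1ℚ 1 0
Yₚ = mono 1ℚ 0 1

Poly2-rawRing : RawRing 0ℓ 0ℓ
Poly2-rawRing = record
  { Carrier = Poly2
  ; _≈_ = λ p q → ∀ i j → p i j ≡ q i j
  ; _+_ = _+ₚ_
  ; _*_ = _*ₚ_
  ; -_  = -ₚ_
  ; 0#  = 0ₚ
  ; 1#  = 1ₚ
  }

-- (a : ℤ) / (b : ℕ) as a rational; the b = 0 case never occurs in P_d
-- for d ≥ 1 (there d - k - 2l ≥ 1), so its value is irrelevant.
divℕ : ℤ → ℕ → ℚ
divℕ a zero    = 0ℚ
divℕ a (suc b) = a ℚ./ suc b

-- (-1)^(k-1) = - (-1)^k
sgn : ℕ → ℤ
sgn zero          = ℤ.-[1+ 0 ]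
sgn (suc zero)    = + 1
sgn (suc (suc k)) = sgn k

coeffP : ℕ → ℕ → ℕ → ℚ
coeffP d k l =
  divℕ (+ d ℤ.* sgn k ℤ.* + ((k ℕ.+ l) C k) ℤ.* + ((d ∸ k ∸ 2 ℕ.* l) C (k ℕ.+ l)))
       (d ∸ k ∸ 2 ℕ.* l)

-- P_d = Σ_{k,l ≥ 0, 2k+3l ≤ d} coeffP d k l · X^k Y^(d-2k-3l)
-- (k and l range over 0..d, which covers all pairs with 2k+3l ≤ d)
P : ℕ → Poly2
P d = sumP d λ k → sumP d λ l →
        if 2 ℕ.* k ℕ.+ 3 ℕ.* l ≤ᵇ d
        then mono (coeffP d k l) k (d ∸ (2 ℕ.* k ℕ.+ 3 ℕ.* l))
        else 0ₚ
  where
  sumP : ℕ → (ℕ → Poly2) → Poly2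
  sumP n g i j = sumTo n λ a → g a i j

-- Write Q_d = -f_d(Y, X, 1). The Newton identities give Q_{n+4} = Y Q_{n+3} - X Q_{n+2} + Q_{n+1},
-- and P_d = Q_d for d = 1, 2, 3 by direct computation, so it suffices that P obeys the same
-- recursion. The coefficient of X^k Y^a in P_d vanishes unless d = a + 2k + 3l for some l, and is
-- then (-1)^(k-1) N(a,k,l) with N(a,k,l) = d (a+k+l-1)! / (a! k! l!). Comparing coefficients, the
-- recursion becomes N(a,k,l) = N(a-1,k,l) + N(a,k-1,l) + N(a,k,l-1), which follows from Pascal's
-- rule for the multinomial coefficient M(a,k,l) = (a+k+l)! / (a! k! l!) and the absorption
-- identities a M(a,k,l) = (a+k+l) M(a-1,k,l), and likewise for k and l.

module Submission where

open import Data.Nat as ℕ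
  using (ℕ; zero; suc; _+_; _*_; _∸_; _≤_; _<_; z≤n; s≤s; _!; NonZero)
open import Data.Nat.Properties as ℕ
  using (+-suc; *-zeroʳ; *-cancelʳ-≡; *-cancelˡ-≡; +-cancelʳ-≡; m+n∸m≡n; m≤m+n; m*n≢0; _!≢0; _!*_!≢0)
open import Data.Nat.Combinatorics using (_C_; nCk≡n!/k![n-k]!; k![n∸k]!∣n!)
open import Data.Nat.DivMod using (_/_; m/n*n≡m)
import Data.Nat.Tactic.RingSolver as ℕ-Solver
open import Data.Integer as ℤ using (ℤ; +_)
import Data.Integer.Properties as ℤ
import Data.Integer.Tactic.RingSolver as ℤ-Solver
open import Data.Rational as ℚ using (ℚ; 0ℚ; 1ℚ)
import Data.Rational.Properties as ℚ
open import Data.Rational.Unnormalised as ℚᵘ using (mkℚᵘ; *≡*)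
import Data.Rational.Unnormalised.Properties as ℚᵘ
open import Data.Bool using (if_then_else_)
open import Data.Bool.Properties using (∧-zeroʳ)
open import Data.Product using (∃-syntax; _,_; map₂)
open import Data.Sum using (_⊎_; inj₁; inj₂)
open import Function using (_∘_)
open import Relation.Nullary using (¬_; Dec; yes; no)
open import Relation.Nullary.Decidable using (dec-true; dec-false; map′)
open import Relation.Binary.PropositionalEquality
open import Algebra.Bundles.Raw using (RawRing)
open import Defs

open RawRing Poly2-rawRing using (_≈_)

ι : ℤ → ℚ
ι x = x ℚ./ 1

ι-+ : ∀ x y → ι (x ℤ.+ y) ≡ ι x ℚ.+ ι y
ι-+ x y = ℚ.toℚᵘ-injective (begin
  ℚ.toℚᵘ (ι (x ℤ.+ y))                 ≈⟨ ℚ.toℚᵘ-fromℚᵘ (mkℚᵘ (x ℤ.+ y) 0) ⟩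
  mkℚᵘ (x ℤ.+ y) 0                     ≈⟨ *≡* (cross-multiplied x y) ⟩
  mkℚᵘ x 0 ℚᵘ.+ mkℚᵘ y 0               ≈⟨ ℚᵘ.+-cong (ℚ.toℚᵘ-fromℚᵘ (mkℚᵘ x 0)) (ℚ.toℚᵘ-fromℚᵘ (mkℚᵘ y 0)) ⟨
  ℚ.toℚᵘ (ι x) ℚᵘ.+ ℚ.toℚᵘ (ι y)       ≈⟨ ℚ.toℚᵘ-homo-+ (ι x) (ι y) ⟨
  ℚ.toℚᵘ (ι x ℚ.+ ι y)                 ∎)
  where
  open ℚᵘ.≃-Reasoning
  cross-multiplied : ∀ x y → (x ℤ.+ y) ℤ.* + 1 ≡ (x ℤ.* + 1 ℤ.+ y ℤ.* + 1) ℤ.* + 1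
  cross-multiplied = ℤ-Solver.solve-∀

ι-neg : ∀ x → ι (ℤ.- x) ≡ ℚ.- ι x
ι-neg x = ℚ.toℚᵘ-injective (begin
  ℚ.toℚᵘ (ι (ℤ.- x))       ≈⟨ ℚ.toℚᵘ-fromℚᵘ (mkℚᵘ (ℤ.- x) 0) ⟩
  ℚᵘ.- mkℚᵘ x 0            ≈⟨ ℚᵘ.-‿cong (ℚ.toℚᵘ-fromℚᵘ (mkℚᵘ x 0)) ⟨
  ℚᵘ.- ℚ.toℚᵘ (ι x)        ≈⟨ ℚ.toℚᵘ-homo‿- (ι x) ⟨
  ℚ.toℚᵘ (ℚ.- ι x)         ∎)
  where open ℚᵘ.≃-Reasoning

divℕ-* : ∀ x m → divℕ (x ℤ.* + suc m) (suc m) ≡ ι x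
divℕ-* x m = ℚ.fromℚᵘ-cong {mkℚᵘ (x ℤ.* + suc m) m} {mkℚᵘ x 0} (*≡* (cross-multiplied x (+ suc m)))
  where
  cross-multiplied : ∀ x n → x ℤ.* n ℤ.* + 1 ≡ x ℤ.* n
  cross-multiplied = ℤ-Solver.solve-∀

open ≡-Reasoning

-- The monomial σ₁^a σ₂^k σ₃^l of f_d becomes X^k Y^a under σ = (Y, X, 1), and d = weight a k l.
total weight : ℕ → ℕ → ℕ → ℕ
total  a k l = k + l + a
weight a k l = a + (2 * k + 3 * l)

weight-sucᵏ : ∀ a k l → weight a (suc k) l ≡ 2 + weight a k l
weight-sucᵏ a k l = expanded a k l
  where
  expanded : ∀ a k l → a + (2 * suc k + 3 * l) ≡ 2 + (a + (2 * k + 3 * l))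
  expanded = ℕ-Solver.solve-∀

weight-sucˡ : ∀ a k l → weight a k (suc l) ≡ 3 + weight a k l
weight-sucˡ a k l = expanded a k l
  where
  expanded : ∀ a k l → a + (2 * k + 3 * suc l) ≡ 3 + (a + (2 * k + 3 * l))
  expanded = ℕ-Solver.solve-∀

weight∸k∸2l : ∀ a k l → weight a k l ∸ k ∸ 2 * l ≡ total a k l
weight∸k∸2l a k l = begin
  weight a k l ∸ k ∸ 2 * l                  ≡⟨ cong (λ n → n ∸ k ∸ 2 * l) (regroup a k l) ⟩
  total a k l + 2 * l + k ∸ k ∸ 2 * l       ≡⟨ cong (_∸ 2 * l) (ℕ.m+n∸n≡m (total a k l + 2 * l) k) ⟩
  total a k l + 2 * l ∸ 2 * l               ≡⟨ ℕ.m+n∸n≡m (total a k l) (2 * l) ⟩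
  total a k l                               ∎
  where
  regroup : ∀ a k l → a + (2 * k + 3 * l) ≡ k + l + a + 2 * l + k
  regroup = ℕ-Solver.solve-∀

weight≤3*total : ∀ a k l → weight a k l ≤ 3 * total a k l
weight≤3*total a k l = subst (weight a k l ≤_) (regroup a k l) (ℕ.m≤m+n (weight a k l) (2 * a + k))
  where
  regroup : ∀ a k l → a + (2 * k + 3 * l) + (2 * a + k) ≡ 3 * (k + l + a)
  regroup = ℕ-Solver.solve-∀

total-positive : ∀ a k l t {n} → weight a k l ≡ 3 * t + suc n → ∃[ m ] total a k l ≡ suc t + m
total-positive a k l t {n} w≡3t+1+n = map₂ sym (ℕ.m≤n⇒∃[o]m+o≡n (ℕ.*-cancelˡ-< 3 t (total a k l) 3t<3total))
  where
  3t<3total : 3 * t < 3 * total a k l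
  3t<3total = ℕ.<-≤-trans (subst (3 * t <_) (sym w≡3t+1+n) (ℕ.m<m+n (3 * t) (s≤s z≤n))) (weight≤3*total a k l)

k≤weight : ∀ a k l → k ≤ weight a k l
k≤weight a k l = ℕ.m≤n⇒m≤o+n a (ℕ.≤-trans (ℕ.m≤m+n k (k + 0)) (ℕ.m≤m+n (2 * k) (3 * l)))

l≤weight : ∀ a k l → l ≤ weight a k l
l≤weight a k l = ℕ.m≤n⇒m≤o+n a (ℕ.m≤n⇒m≤o+n (2 * k) (ℕ.m≤m+n l (l + (l + 0))))

weight-injectiveˡ : ∀ a k {l l′} → weight a k l ≡ weight a k l′ → l ≡ l′
weight-injectiveˡ a k {l} {l′} eq = ℕ.*-cancelˡ-≡ l l′ 3 (ℕ.+-cancelˡ-≡ (2 * k) _ _ (ℕ.+-cancelˡ-≡ a _ _ eq))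

weight≡? : ∀ a k d → Dec (∃[ l ] weight a k l ≡ d)
weight≡? a k d = map′ (λ (l , _ , e) → l , e) (λ (l , e) → l , s≤s (subst (l ≤_) e (l≤weight a k l)) , e)
                      (ℕ.anyUpTo? (λ l → weight a k l ℕ.≟ d) (suc d))

binomial-! : ∀ x y → ((x + y) C x) * (x ! * y !) ≡ (x + y) !
binomial-! x y = begin
  ((x + y) C x) * (x ! * y !)            ≡⟨ cong (λ z → ((x + y) C x) * (x ! * z !)) (sym (m+n∸m≡n x y)) ⟩
  ((x + y) C x) * (x ! * (x + y ∸ x) !)  ≡⟨ cong (_* (x ! * (x + y ∸ x) !)) (nCk≡n!/k![n-k]! x≤x+y) ⟩
  (x + y) ! / (x ! * (x + y ∸ x) !) * (x ! * (x + y ∸ x) !) ≡⟨ m/n*n≡m (k![n∸k]!∣n! x≤x+y) ⟩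
  (x + y) !                              ∎
  where
  x≤x+y : x ≤ x + y
  x≤x+y = m≤m+n x y
  instance
    nonZero : NonZero (x ! * (x + y ∸ x) !)
    nonZero = x !* (x + y ∸ x) !≢0

multinomial factorials : ℕ → ℕ → ℕ → ℕ
multinomial a k l = ((k + l) C k) * (total a k l C (k + l))
factorials  a k l = k ! * l ! * a !

multinomial-! : ∀ a k l → multinomial a k l * factorials a k l ≡ total a k l !
multinomial-! a k l = begin
  ((k + l) C k) * (total a k l C (k + l)) * (k ! * l ! * a !)   ≡⟨ regroup ((k + l) C k) _ (k !) (l !) (a !) ⟩
  (total a k l C (k + l)) * (((k + l) C k) * (k ! * l !) * a !)     ≡⟨ cong (λ z → (total a k l C (k + l)) * (z * a !)) (binomial-! k l) ⟩
  (total a k l C (k + l)) * ((k + l) ! * a !)                   ≡⟨ binomial-! (k + l) a ⟩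
  total a k l !                                                 ∎
  where
  regroup : ∀ c d x y z → c * d * (x * y * z) ≡ d * (c * (x * y) * z)
  regroup = ℕ-Solver.solve-∀

cancel-factorials : ∀ a k l {x y} → x * factorials a k l ≡ y * factorials a k l → x ≡ y
cancel-factorials a k l {x} {y} = *-cancelʳ-≡ x y (factorials a k l) {{m*n≢0 _ _ {{k !* l !≢0}} {{a !≢0}}}}

lowerᵃ lowerᵏ lowerˡ : (ℕ → ℕ → ℕ → ℕ) → ℕ → ℕ → ℕ → ℕ
lowerᵃ g zero    k l = 0
lowerᵃ g (suc a) k l = g a k l
lowerᵏ g a zero    l = 0
lowerᵏ g a (suc k) l = g a k l
lowerˡ g a k zero    = 0
lowerˡ g a k (suc l) = g a k l

suc-total-! : ∀ a k l {n} → n ≡ suc (total a k l) → n ! ≡ n * multinomial a k l * factorials a k l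
suc-total-! a k l {n} refl = begin
  n * total a k l !                           ≡⟨ cong (n *_) (multinomial-! a k l) ⟨
  n * (multinomial a k l * factorials a k l)  ≡⟨ ℕ.*-assoc n (multinomial a k l) (factorials a k l) ⟨
  n * multinomial a k l * factorials a k l    ∎

absorptionᵃ : ∀ a k l → a * multinomial a k l ≡ total a k l * lowerᵃ multinomial a k l
absorptionᵃ zero    k l = sym (*-zeroʳ (total 0 k l))
absorptionᵃ (suc a) k l = cancel-factorials a k l (begin
  suc a * multinomial (suc a) k l * factorials a k l  ≡⟨ regroup (suc a) (multinomial (suc a) k l) (k !) (l !) (a !) ⟩
  multinomial (suc a) k l * factorials (suc a) k l    ≡⟨ multinomial-! (suc a) k l ⟩
  total (suc a) k l !                                 ≡⟨ suc-total-! a k l (+-suc (k + l) a) ⟩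
  total (suc a) k l * multinomial a k l * factorials a k l ∎)
  where
  regroup : ∀ s m x y z → s * m * (x * y * z) ≡ m * (x * y * (s * z))
  regroup = ℕ-Solver.solve-∀

absorptionᵏ : ∀ a k l → k * multinomial a k l ≡ total a k l * lowerᵏ multinomial a k l
absorptionᵏ a zero    l = sym (*-zeroʳ (total a 0 l))
absorptionᵏ a (suc k) l = cancel-factorials a k l (begin
  suc k * multinomial a (suc k) l * factorials a k l  ≡⟨ regroup (suc k) (multinomial a (suc k) l) (k !) (l !) (a !) ⟩
  multinomial a (suc k) l * factorials a (suc k) l    ≡⟨ multinomial-! a (suc k) l ⟩
  total a (suc k) l !                                 ≡⟨ suc-total-! a k l refl ⟩
  total a (suc k) l * multinomial a k l * factorials a k l ∎)
  where
  regroup : ∀ s m x y z → s * m * (x * y * z) ≡ m * (s * x * y * z)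
  regroup = ℕ-Solver.solve-∀

absorptionˡ : ∀ a k l → l * multinomial a k l ≡ total a k l * lowerˡ multinomial a k l
absorptionˡ a k zero    = sym (*-zeroʳ (total a k 0))
absorptionˡ a k (suc l) = cancel-factorials a k l (begin
  suc l * multinomial a k (suc l) * factorials a k l  ≡⟨ regroup (suc l) (multinomial a k (suc l)) (k !) (l !) (a !) ⟩
  multinomial a k (suc l) * factorials a k (suc l)    ≡⟨ multinomial-! a k (suc l) ⟩
  total a k (suc l) !                                 ≡⟨ suc-total-! a k l (cong (_+ a) (+-suc k l)) ⟩
  total a k (suc l) * multinomial a k l * factorials a k l ∎)
  where
  regroup : ∀ s m x y z → s * m * (x * y * z) ≡ m * (x * (s * y) * z)
  regroup = ℕ-Solver.solve-∀

multinomial-pascal : ∀ a k l → .{{NonZero (total a k l)}} →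
                     multinomial a k l ≡ lowerᵃ multinomial a k l + lowerᵏ multinomial a k l + lowerˡ multinomial a k l
multinomial-pascal a k l = *-cancelˡ-≡ M (Mᵃ + Mᵏ + Mˡ) n (begin
  n * M                       ≡⟨ distrib k l a M ⟩
  a * M + k * M + l * M       ≡⟨ cong₂ _+_ (cong₂ _+_ (absorptionᵃ a k l) (absorptionᵏ a k l)) (absorptionˡ a k l) ⟩
  n * Mᵃ + n * Mᵏ + n * Mˡ    ≡⟨ factor n Mᵃ Mᵏ Mˡ ⟩
  n * (Mᵃ + Mᵏ + Mˡ)          ∎)
  where
  M Mᵃ Mᵏ Mˡ n : ℕ
  M  = multinomial a k l
  Mᵃ = lowerᵃ multinomial a k l
  Mᵏ = lowerᵏ multinomial a k l
  Mˡ = lowerˡ multinomial a k l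
  n  = total a k l
  distrib : ∀ k l a m → (k + l + a) * m ≡ a * m + k * m + l * m
  distrib = ℕ-Solver.solve-∀
  factor : ∀ n x y z → n * x + n * y + n * z ≡ n * (x + y + z)
  factor = ℕ-Solver.solve-∀

-- weight · (total - 1)! / (a! k! l!), written so that it is visibly a natural number.
waring : ℕ → ℕ → ℕ → ℕ
waring a k l = lowerᵃ multinomial a k l + 2 * lowerᵏ multinomial a k l + 3 * lowerˡ multinomial a k l

weight*multinomial : ∀ a k l → weight a k l * multinomial a k l ≡ total a k l * waring a k l
weight*multinomial a k l = begin
  weight a k l * M                    ≡⟨ distrib a k l M ⟩
  a * M + 2 * (k * M) + 3 * (l * M)   ≡⟨ cong₂ _+_ (cong₂ (λ x y → x + 2 * y) (absorptionᵃ a k l) (absorptionᵏ a k l))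
                                                   (cong (3 *_) (absorptionˡ a k l)) ⟩
  n * Mᵃ + 2 * (n * Mᵏ) + 3 * (n * Mˡ) ≡⟨ factor n Mᵃ Mᵏ Mˡ ⟩
  n * waring a k l                    ∎
  where
  M Mᵃ Mᵏ Mˡ n : ℕ
  M  = multinomial a k l
  Mᵃ = lowerᵃ multinomial a k l
  Mᵏ = lowerᵏ multinomial a k l
  Mˡ = lowerˡ multinomial a k l
  n  = total a k l
  distrib : ∀ a k l m → (a + (2 * k + 3 * l)) * m ≡ a * m + 2 * (k * m) + 3 * (l * m)
  distrib = ℕ-Solver.solve-∀
  factor : ∀ n x y z → n * x + 2 * (n * y) + 3 * (n * z) ≡ n * (x + 2 * y + 3 * z)
  factor = ℕ-Solver.solve-∀

-- weight*multinomial at x - e for the unit vectors e of weight 1, 2, 3, with all subtractions moved across.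
lowerᵃ-weight*multinomial : ∀ a k l {m} → total a k l ≡ suc m →
  m * lowerᵃ waring a k l + lowerᵃ multinomial a k l ≡ weight a k l * lowerᵃ multinomial a k l
lowerᵃ-weight*multinomial zero k l {m} _ = trans (cong (_+ 0) (*-zeroʳ m)) (sym (*-zeroʳ (weight 0 k l)))
lowerᵃ-weight*multinomial (suc a) k l {m} total≡1+m = begin
  m * waring a k l + multinomial a k l             ≡⟨ cong (λ n → n * waring a k l + multinomial a k l) m≡total ⟩
  total a k l * waring a k l + multinomial a k l   ≡⟨ cong (_+ multinomial a k l) (weight*multinomial a k l) ⟨
  weight a k l * multinomial a k l + multinomial a k l ≡⟨ ℕ.+-comm _ (multinomial a k l) ⟩
  suc (weight a k l) * multinomial a k l           ∎
  where
  m≡total : m ≡ total a k l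
  m≡total = ℕ.suc-injective (trans (sym total≡1+m) (+-suc (k + l) a))

lowerᵏ-weight*multinomial : ∀ a k l {m} → total a k l ≡ suc m →
  m * lowerᵏ waring a k l + 2 * lowerᵏ multinomial a k l ≡ weight a k l * lowerᵏ multinomial a k l
lowerᵏ-weight*multinomial a zero l {m} _ = trans (cong (_+ 0) (*-zeroʳ m)) (sym (*-zeroʳ (weight a 0 l)))
lowerᵏ-weight*multinomial a (suc k) l refl = begin
  total a k l * waring a k l + 2 * multinomial a k l     ≡⟨ cong (_+ 2 * multinomial a k l) (weight*multinomial a k l) ⟨
  weight a k l * multinomial a k l + 2 * multinomial a k l ≡⟨ regroup a k l (multinomial a k l) ⟩
  weight a (suc k) l * multinomial a k l                 ∎
  where
  regroup : ∀ a k l m → (a + (2 * k + 3 * l)) * m + 2 * m ≡ (a + (2 * suc k + 3 * l)) * m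
  regroup = ℕ-Solver.solve-∀

lowerˡ-weight*multinomial : ∀ a k l {m} → total a k l ≡ suc m →
  m * lowerˡ waring a k l + 3 * lowerˡ multinomial a k l ≡ weight a k l * lowerˡ multinomial a k l
lowerˡ-weight*multinomial a k zero {m} _ = trans (cong (_+ 0) (*-zeroʳ m)) (sym (*-zeroʳ (weight a k 0)))
lowerˡ-weight*multinomial a k (suc l) {m} total≡1+m = begin
  m * waring a k l + 3 * multinomial a k l               ≡⟨ cong (λ n → n * waring a k l + 3 * multinomial a k l) m≡total ⟩
  total a k l * waring a k l + 3 * multinomial a k l     ≡⟨ cong (_+ 3 * multinomial a k l) (weight*multinomial a k l) ⟨
  weight a k l * multinomial a k l + 3 * multinomial a k l ≡⟨ regroup a k l (multinomial a k l) ⟩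
  weight a k (suc l) * multinomial a k l                 ∎
  where
  m≡total : m ≡ total a k l
  m≡total = ℕ.suc-injective (trans (sym total≡1+m) (cong (_+ a) (+-suc k l)))
  regroup : ∀ a k l m → (a + (2 * k + 3 * l)) * m + 3 * m ≡ (a + (2 * k + 3 * suc l)) * m
  regroup = ℕ-Solver.solve-∀

-- Multiplied by total - 1 = suc m, the three lowered identities add up, by Pascal's rule, to
-- weight * multinomial = total * waring.
waring-pascal : ∀ a k l {m} → total a k l ≡ suc (suc m) →
                waring a k l ≡ lowerᵃ waring a k l + lowerᵏ waring a k l + lowerˡ waring a k l
waring-pascal a k l {m} total≡2+m = sym (*-cancelˡ-≡ _ _ (suc m) (+-cancelʳ-≡ (waring a k l) _ _ (begin
  suc m * (Nᵃ + Nᵏ + Nˡ) + waring a k l     ≡⟨ regroup (suc m) Nᵃ Nᵏ Nˡ Mᵃ Mᵏ Mˡ ⟩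
  (suc m * Nᵃ + Mᵃ) + (suc m * Nᵏ + 2 * Mᵏ) + (suc m * Nˡ + 3 * Mˡ)
      ≡⟨ cong₂ _+_ (cong₂ _+_ (lowerᵃ-weight*multinomial a k l total≡2+m) (lowerᵏ-weight*multinomial a k l total≡2+m))
                   (lowerˡ-weight*multinomial a k l total≡2+m) ⟩
  w * Mᵃ + w * Mᵏ + w * Mˡ                  ≡⟨ factor w Mᵃ Mᵏ Mˡ ⟩
  w * (Mᵃ + Mᵏ + Mˡ)                        ≡⟨ cong (w *_) (multinomial-pascal a k l {{nonZero}}) ⟨
  w * multinomial a k l                     ≡⟨ weight*multinomial a k l ⟩
  total a k l * waring a k l                ≡⟨ cong (_* waring a k l) total≡2+m ⟩
  waring a k l + suc m * waring a k l       ≡⟨ ℕ.+-comm (waring a k l) _ ⟩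
  suc m * waring a k l + waring a k l       ∎)))
  where
  Nᵃ Nᵏ Nˡ Mᵃ Mᵏ Mˡ w : ℕ
  Nᵃ = lowerᵃ waring a k l
  Nᵏ = lowerᵏ waring a k l
  Nˡ = lowerˡ waring a k l
  Mᵃ = lowerᵃ multinomial a k l
  Mᵏ = lowerᵏ multinomial a k l
  Mˡ = lowerˡ multinomial a k l
  w = weight a k l
  nonZero : NonZero (total a k l)
  nonZero = subst NonZero (sym total≡2+m) _
  regroup : ∀ s x y z p q r → s * (x + y + z) + (p + 2 * q + 3 * r) ≡ (s * x + p) + (s * y + 2 * q) + (s * z + 3 * r)
  regroup = ℕ-Solver.solve-∀
  factor : ∀ w x y z → w * x + w * y + w * z ≡ w * (x + y + z)
  factor = ℕ-Solver.solve-∀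

signed : ℕ → ℕ → ℚ
signed k n = ι (sgn k ℤ.* + n)

signed-zero : ∀ k → signed k 0 ≡ 0ℚ
signed-zero k = cong ι (ℤ.*-zeroʳ (sgn k))

signed-+ : ∀ k m n → signed k (m + n) ≡ signed k m ℚ.+ signed k n
signed-+ k m n = begin
  ι (sgn k ℤ.* + (m + n))                 ≡⟨ cong (λ x → ι (sgn k ℤ.* x)) (ℤ.pos-+ m n) ⟩
  ι (sgn k ℤ.* (+ m ℤ.+ + n))             ≡⟨ cong ι (ℤ.*-distribˡ-+ (sgn k) (+ m) (+ n)) ⟩
  ι (sgn k ℤ.* + m ℤ.+ sgn k ℤ.* + n)     ≡⟨ ι-+ (sgn k ℤ.* + m) (sgn k ℤ.* + n) ⟩
  signed k m ℚ.+ signed k n               ∎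

sgn-suc : ∀ k → sgn (suc k) ≡ ℤ.- sgn k
sgn-suc zero          = refl
sgn-suc (suc zero)    = refl
sgn-suc (suc (suc k)) = sgn-suc k

signed-suc : ∀ k n → signed (suc k) n ≡ ℚ.- signed k n
signed-suc k n = begin
  ι (sgn (suc k) ℤ.* + n)        ≡⟨ cong (λ s → ι (s ℤ.* + n)) (sgn-suc k) ⟩
  ι (ℤ.- sgn k ℤ.* + n)          ≡⟨ cong ι (ℤ.neg-distribˡ-* (sgn k) (+ n)) ⟨
  ι (ℤ.- (sgn k ℤ.* + n))        ≡⟨ ι-neg (sgn k ℤ.* + n) ⟩
  ℚ.- signed k n                 ∎

waringCoeff : ℕ → ℕ → ℕ → ℚ
waringCoeff a k l = signed k (waring a k l)

coeffP-weight : ∀ a k l {m} → total a k l ≡ suc m → coeffP (weight a k l) k l ≡ waringCoeff a k l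
coeffP-weight a k l {m} total≡1+m = begin
  coeffP (weight a k l) k l
    ≡⟨ cong (λ n → divℕ (+ w ℤ.* sgn k ℤ.* + C₁ ℤ.* + (n C (k + l))) n) (trans (weight∸k∸2l a k l) total≡1+m) ⟩
  divℕ (+ w ℤ.* sgn k ℤ.* + C₁ ℤ.* + (suc m C (k + l))) (suc m)
    ≡⟨ cong (λ z → divℕ z (suc m)) numerator ⟩
  divℕ (sgn k ℤ.* + waring a k l ℤ.* + suc m) (suc m)
    ≡⟨ divℕ-* (sgn k ℤ.* + waring a k l) m ⟩
  waringCoeff a k l ∎
  where
  w C₁ C₂ : ℕ
  w  = weight a k l
  C₁ = (k + l) C k
  C₂ = suc m C (k + l)
  regroup : ∀ w s c₁ c₂ → w ℤ.* s ℤ.* c₁ ℤ.* c₂ ≡ s ℤ.* (w ℤ.* (c₁ ℤ.* c₂))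
  regroup = ℤ-Solver.solve-∀
  weight*C₁*C₂ : w * (C₁ * C₂) ≡ waring a k l * suc m
  weight*C₁*C₂ = begin
    w * (C₁ * C₂)                ≡⟨ cong (λ n → w * (C₁ * (n C (k + l)))) total≡1+m ⟨
    w * multinomial a k l        ≡⟨ weight*multinomial a k l ⟩
    total a k l * waring a k l   ≡⟨ cong (_* waring a k l) total≡1+m ⟩
    suc m * waring a k l         ≡⟨ ℕ.*-comm (suc m) (waring a k l) ⟩
    waring a k l * suc m         ∎
  numerator : + w ℤ.* sgn k ℤ.* + C₁ ℤ.* + C₂ ≡ sgn k ℤ.* + waring a k l ℤ.* + suc m
  numerator = begin
    + w ℤ.* sgn k ℤ.* + C₁ ℤ.* + C₂           ≡⟨ regroup (+ w) (sgn k) (+ C₁) (+ C₂) ⟩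
    sgn k ℤ.* (+ w ℤ.* (+ C₁ ℤ.* + C₂))       ≡⟨ cong (λ z → sgn k ℤ.* (+ w ℤ.* z)) (ℤ.pos-* C₁ C₂) ⟨
    sgn k ℤ.* (+ w ℤ.* + (C₁ * C₂))           ≡⟨ cong (sgn k ℤ.*_) (ℤ.pos-* w (C₁ * C₂)) ⟨
    sgn k ℤ.* + (w * (C₁ * C₂))               ≡⟨ cong (λ n → sgn k ℤ.* + n) weight*C₁*C₂ ⟩
    sgn k ℤ.* + (waring a k l * suc m)        ≡⟨ cong (sgn k ℤ.*_) (ℤ.pos-* (waring a k l) (suc m)) ⟩
    sgn k ℤ.* (+ waring a k l ℤ.* + suc m)    ≡⟨ ℤ.*-assoc (sgn k) (+ waring a k l) (+ suc m) ⟨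
    sgn k ℤ.* + waring a k l ℤ.* + suc m      ∎

sumTo-cong : ∀ n {g h : ℕ → ℚ} → (∀ x → g x ≡ h x) → sumTo n g ≡ sumTo n h
sumTo-cong zero    g≡h = g≡h zero
sumTo-cong (suc n) g≡h = cong₂ ℚ._+_ (sumTo-cong n g≡h) (g≡h (suc n))

sumTo-zero : ∀ n (g : ℕ → ℚ) → (∀ x → x ≤ n → g x ≡ 0ℚ) → sumTo n g ≡ 0ℚ
sumTo-zero zero    g g≡0 = g≡0 0 z≤n
sumTo-zero (suc n) g g≡0 =
  cong₂ ℚ._+_ (sumTo-zero n g (λ x x≤n → g≡0 x (ℕ.m≤n⇒m≤1+n x≤n))) (g≡0 (suc n) ℕ.≤-refl)

sumTo-single : ∀ n m (g : ℕ → ℚ) → m ≤ n → (∀ x → x ≢ m → g x ≡ 0ℚ) → sumTo n g ≡ g m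
sumTo-single zero    zero g _   _   = refl
sumTo-single (suc n) m    g m≤n g≡0 with m ℕ.≟ suc n
... | yes refl = trans (cong (ℚ._+ g (suc n)) (sumTo-zero n g (λ x x≤n → g≡0 x (ℕ.<⇒≢ (s≤s x≤n)))))
                       (ℚ.+-identityˡ (g (suc n)))
... | no m≢1+n = trans (cong₂ ℚ._+_ (sumTo-single n m g (ℕ.≤-pred (ℕ.≤∧≢⇒< m≤n m≢1+n)) g≡0) (g≡0 (suc n) (m≢1+n ∘ sym)))
                       (ℚ.+-identityʳ (g m))

sumTo-outside : ∀ n m (g : ℕ → ℚ) → n < m → (∀ x → x ≢ m → g x ≡ 0ℚ) → sumTo n g ≡ 0ℚ
sumTo-outside n m g n<m g≡0 = sumTo-zero n g (λ x x≤n → g≡0 x (ℕ.<⇒≢ (ℕ.≤-<-trans x≤n n<m)))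

mono-diag : ∀ c u v → mono c u v u v ≡ c
mono-diag c u v rewrite dec-true (u ℕ.≟ u) refl | dec-true (v ℕ.≟ v) refl = refl

mono-offˣ : ∀ c u v i j → i ≢ u → mono c u v i j ≡ 0ℚ
mono-offˣ c u v i j i≢u rewrite dec-false (i ℕ.≟ u) i≢u = refl

mono-offʸ : ∀ c u v i j → j ≢ v → mono c u v i j ≡ 0ℚ
mono-offʸ c u v i j j≢v rewrite dec-false (j ℕ.≟ v) j≢v | ∧-zeroʳ (i ℕ.≡ᵇ u) = refl

shift : ℕ → ℕ → Poly2 → Poly2
shift zero    zero    p i       j       = p i j
shift zero    (suc v) p i       zero    = 0ℚ
shift zero    (suc v) p i       (suc j) = shift zero v p i j
shift (suc u) v       p zero    j       = 0ℚ
shift (suc u) v       p (suc i) j       = shift u v p i j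

shift-inside : ∀ u v p i j → u ≤ i → v ≤ j → shift u v p i j ≡ p (i ∸ u) (j ∸ v)
shift-inside zero    zero    p i       j       _         _         = refl
shift-inside zero    (suc v) p i       (suc j) _         (s≤s v≤j) = shift-inside zero v p i j z≤n v≤j
shift-inside (suc u) v       p (suc i) j       (s≤s u≤i) v≤j       = shift-inside u v p i j u≤i v≤j

shift-outsideˣ : ∀ u v p i j → i < u → shift u v p i j ≡ 0ℚ
shift-outsideˣ (suc u) v p zero    j _         = refl
shift-outsideˣ (suc u) v p (suc i) j (s≤s i<u) = shift-outsideˣ u v p i j i<u

shift-outsideʸ : ∀ u v p i j → j < v → shift u v p i j ≡ 0ℚ
shift-outsideʸ zero    (suc v) p i       zero    _         = refl
shift-outsideʸ zero    (suc v) p i       (suc j) (s≤s j<v) = shift-outsideʸ zero v p i j j<v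
shift-outsideʸ (suc u) v       p zero    j       _         = refl
shift-outsideʸ (suc u) v       p (suc i) j       j<v       = shift-outsideʸ u v p i j j<v

shift-neg : ∀ u v p → shift u v (-ₚ p) ≈ -ₚ shift u v p
shift-neg zero    zero    p i       j       = refl
shift-neg zero    (suc v) p i       zero    = refl
shift-neg zero    (suc v) p i       (suc j) = shift-neg zero v p i j
shift-neg (suc u) v       p zero    j       = refl
shift-neg (suc u) v       p (suc i) j       = shift-neg u v p i j

shift-cong : ∀ u v {p q} → p ≈ q → shift u v p ≈ shift u v q
shift-cong zero    zero    p≈q i       j       = p≈q i j
shift-cong zero    (suc v) p≈q i       zero    = refl
shift-cong zero    (suc v) p≈q i       (suc j) = shift-cong zero v p≈q i j
shift-cong (suc u) v       p≈q zero    j       = refl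
shift-cong (suc u) v       p≈q (suc i) j       = shift-cong u v p≈q i j

shift-mono : ∀ c u v w → shift 0 v (mono c u w) ≈ mono c u (v + w)
shift-mono c u zero    w i j       = refl
shift-mono c u (suc v) w i zero    = cong (if_then c else 0ℚ) (sym (∧-zeroʳ (i ℕ.≡ᵇ u)))
shift-mono c u (suc v) w i (suc j) = shift-mono c u v w i j

module _ (u v : ℕ) (p : Poly2) (i j : ℕ) where

  private
    term : ℕ → ℕ → ℚ
    term a b = mono 1ℚ u v a b ℚ.* p (i ∸ a) (j ∸ b)

    term-offʸ : ∀ a b → b ≢ v → term a b ≡ 0ℚ
    term-offʸ a b b≢v = trans (cong (ℚ._* p (i ∸ a) (j ∸ b)) (mono-offʸ 1ℚ u v a b b≢v)) (ℚ.*-zeroˡ (p (i ∸ a) (j ∸ b)))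

    row-off : ∀ a → a ≢ u → sumTo j (term a) ≡ 0ℚ
    row-off a a≢u = sumTo-zero j (term a) λ b _ →
      trans (cong (ℚ._* p (i ∸ a) (j ∸ b)) (mono-offˣ 1ℚ u v a b a≢u)) (ℚ.*-zeroˡ (p (i ∸ a) (j ∸ b)))

  mono*ₚ : (mono 1ℚ u v *ₚ p) i j ≡ shift u v p i j
  mono*ₚ with u ℕ.≤? i | v ℕ.≤? j
  ... | no u≰i  | _        = trans (sumTo-outside i u _ (ℕ.≰⇒> u≰i) row-off) (sym (shift-outsideˣ u v p i j (ℕ.≰⇒> u≰i)))
  ... | yes u≤i | no v≰j   = begin
    sumTo i (λ a → sumTo j (term a))   ≡⟨ sumTo-single i u _ u≤i row-off ⟩
    sumTo j (term u)                   ≡⟨ sumTo-outside j v _ (ℕ.≰⇒> v≰j) (term-offʸ u) ⟩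
    0ℚ                                 ≡⟨ shift-outsideʸ u v p i j (ℕ.≰⇒> v≰j) ⟨
    shift u v p i j                    ∎
  ... | yes u≤i | yes v≤j  = begin
    sumTo i (λ a → sumTo j (term a))   ≡⟨ sumTo-single i u _ u≤i row-off ⟩
    sumTo j (term u)                   ≡⟨ sumTo-single j v _ v≤j (term-offʸ u) ⟩
    mono 1ℚ u v u v ℚ.* p (i ∸ u) (j ∸ v) ≡⟨ cong (ℚ._* p (i ∸ u) (j ∸ v)) (mono-diag 1ℚ u v) ⟩
    1ℚ ℚ.* p (i ∸ u) (j ∸ v)           ≡⟨ ℚ.*-identityˡ _ ⟩
    p (i ∸ u) (j ∸ v)                  ≡⟨ shift-inside u v p i j u≤i v≤j ⟨
    shift u v p i j                    ∎

*ₚ-congʳ : ∀ {p p′} q → p ≈ p′ → (p *ₚ q) ≈ (p′ *ₚ q)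
*ₚ-congʳ q p≈p′ i j = sumTo-cong i λ a → sumTo-cong j λ b → cong (ℚ._* q (i ∸ a) (j ∸ b)) (p≈p′ a b)

P-term : ℕ → ℕ → ℕ → Poly2
P-term d k l = if 2 * k + 3 * l ℕ.≤ᵇ d then mono (coeffP d k l) k (d ∸ (2 * k + 3 * l)) else 0ₚ

P-term-off : ∀ d k l i j → k ≢ i ⊎ weight j k l ≢ d → P-term d k l i j ≡ 0ℚ
P-term-off d k l i j off with 2 * k + 3 * l ℕ.≤? d
... | no  s≰d rewrite dec-false (2 * k + 3 * l ℕ.≤? d) s≰d = refl
... | yes s≤d rewrite dec-true  (2 * k + 3 * l ℕ.≤? d) s≤d with off
...   | inj₁ k≢i = mono-offˣ (coeffP d k l) k _ i j (k≢i ∘ sym)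
...   | inj₂ weight≢d = mono-offʸ (coeffP d k l) k _ i j λ j≡d∸s → weight≢d (trans (cong (_+ (2 * k + 3 * l)) j≡d∸s) (ℕ.m∸n+n≡m s≤d))

P-term-diag : ∀ a k l → P-term (weight a k l) k l k a ≡ coeffP (weight a k l) k l
P-term-diag a k l
  rewrite dec-true (2 * k + 3 * l ℕ.≤? weight a k l) (ℕ.m≤n+m (2 * k + 3 * l) a)
        | ℕ.m+n∸n≡m a (2 * k + 3 * l)
        = mono-diag (coeffP (weight a k l) k l) k a

P-coeff : ∀ a k l {n} → weight a k l ≡ suc n → P (suc n) k a ≡ waringCoeff a k l
P-coeff a k l w≡1+n with total-positive a k l 0 w≡1+n
... | m , total≡1+m = subst (λ d → P d k a ≡ waringCoeff a k l) w≡1+n (begin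
  sumTo d (λ k′ → sumTo d (λ l′ → P-term d k′ l′ k a))
    ≡⟨ sumTo-single d k _ (k≤weight a k l) (λ k′ k′≢k → sumTo-zero d _ (λ l′ _ → P-term-off d k′ l′ k a (inj₁ k′≢k))) ⟩
  sumTo d (λ l′ → P-term d k l′ k a)
    ≡⟨ sumTo-single d l _ (l≤weight a k l) (λ l′ l′≢l → P-term-off d k l′ k a (inj₂ (l′≢l ∘ weight-injectiveˡ a k))) ⟩
  P-term d k l k a
    ≡⟨ P-term-diag a k l ⟩
  coeffP d k l
    ≡⟨ coeffP-weight a k l total≡1+m ⟩
  waringCoeff a k l ∎)
  where
  d : ℕ
  d = weight a k l

P-vanishes : ∀ d i j → ¬ (∃[ l ] weight j i l ≡ d) → P d i j ≡ 0ℚ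
P-vanishes d i j ∄l = sumTo-zero d _ λ k _ → sumTo-zero d _ λ l _ → P-term-off d k l i j (off k l)
  where
  off : ∀ k l → k ≢ i ⊎ weight j k l ≢ d
  off k l with k ℕ.≟ i
  ... | yes refl = inj₂ (λ e → ∄l (l , e))
  ... | no  k≢i  = inj₁ k≢i

newton-step : (ℕ → Poly2) → ℕ → Poly2
newton-step p n i j = shift 0 1 (p (3 + n)) i j ℚ.+ ℚ.- shift 1 0 (p (2 + n)) i j ℚ.+ p (1 + n) i j

newton-step-cong : ∀ n {p q : ℕ → Poly2} → p (3 + n) ≈ q (3 + n) → p (2 + n) ≈ q (2 + n) → p (1 + n) ≈ q (1 + n) →
                   newton-step p n ≈ newton-step q n
newton-step-cong n p≈q₃ p≈q₂ p≈q₁ i j =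
  cong₂ ℚ._+_ (cong₂ (λ y x → y ℚ.+ ℚ.- x) (shift-cong 0 1 p≈q₃ i j) (shift-cong 1 0 p≈q₂ i j)) (p≈q₁ i j)

Q : ℕ → Poly2
Q d = -ₚ f Poly2-rawRing d Yₚ Xₚ 1ₚ

Q-rec : ∀ n → Q (4 + n) ≈ newton-step Q n
Q-rec n i j = begin
  ℚ.- ((Yₚ *ₚ F₃) i j ℚ.+ ℚ.- (Xₚ *ₚ F₂) i j ℚ.+ (1ₚ *ₚ F₁) i j)
    ≡⟨ cong₂ (λ y x → ℚ.- (y ℚ.+ ℚ.- x ℚ.+ (1ₚ *ₚ F₁) i j)) (mono*ₚ 0 1 F₃ i j) (mono*ₚ 1 0 F₂ i j) ⟩
  ℚ.- (shift 0 1 F₃ i j ℚ.+ ℚ.- shift 1 0 F₂ i j ℚ.+ (1ₚ *ₚ F₁) i j)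
    ≡⟨ cong (λ z → ℚ.- (shift 0 1 F₃ i j ℚ.+ ℚ.- shift 1 0 F₂ i j ℚ.+ z)) (mono*ₚ 0 0 F₁ i j) ⟩
  ℚ.- (shift 0 1 F₃ i j ℚ.+ ℚ.- shift 1 0 F₂ i j ℚ.+ F₁ i j)
    ≡⟨ ℚ.neg-distrib-+ (shift 0 1 F₃ i j ℚ.+ ℚ.- shift 1 0 F₂ i j) (F₁ i j) ⟩
  ℚ.- (shift 0 1 F₃ i j ℚ.+ ℚ.- shift 1 0 F₂ i j) ℚ.+ Q (1 + n) i j
    ≡⟨ cong (ℚ._+ Q (1 + n) i j) (ℚ.neg-distrib-+ (shift 0 1 F₃ i j) (ℚ.- shift 1 0 F₂ i j)) ⟩
  ℚ.- shift 0 1 F₃ i j ℚ.+ ℚ.- ℚ.- shift 1 0 F₂ i j ℚ.+ Q (1 + n) i j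
    ≡⟨ cong₂ (λ y x → y ℚ.+ ℚ.- x ℚ.+ Q (1 + n) i j) (shift-neg 0 1 F₃ i j) (shift-neg 1 0 F₂ i j) ⟨
  shift 0 1 (Q (3 + n)) i j ℚ.+ ℚ.- shift 1 0 (Q (2 + n)) i j ℚ.+ Q (1 + n) i j ∎
  where
  F₃ F₂ F₁ : Poly2
  F₃ = f Poly2-rawRing (3 + n) Yₚ Xₚ 1ₚ
  F₂ = f Poly2-rawRing (2 + n) Yₚ Xₚ 1ₚ
  F₁ = f Poly2-rawRing (1 + n) Yₚ Xₚ 1ₚ

P-rec-coeff : ∀ n a k l → weight a k l ≡ 4 + n → newton-step P n k a ≡ waringCoeff a k l
P-rec-coeff n a k l w≡4+n with total-positive a k l 1 w≡4+n
... | m , total≡2+m = begin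
  shift 0 1 (P (3 + n)) k a ℚ.+ ℚ.- shift 1 0 (P (2 + n)) k a ℚ.+ P (1 + n) k a
    ≡⟨ cong₂ ℚ._+_ (cong₂ ℚ._+_ (Y-part a w≡4+n) (X-part k w≡4+n)) (one-part l w≡4+n) ⟩
  signed k (lowerᵃ waring a k l) ℚ.+ signed k (lowerᵏ waring a k l) ℚ.+ signed k (lowerˡ waring a k l)
    ≡⟨ cong (ℚ._+ signed k (lowerˡ waring a k l)) (signed-+ k _ _) ⟨
  signed k (lowerᵃ waring a k l + lowerᵏ waring a k l) ℚ.+ signed k (lowerˡ waring a k l)
    ≡⟨ signed-+ k _ _ ⟨
  signed k (lowerᵃ waring a k l + lowerᵏ waring a k l + lowerˡ waring a k l)
    ≡⟨ cong (signed k) (waring-pascal a k l total≡2+m) ⟨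
  waringCoeff a k l ∎
  where
  Y-part : ∀ a → weight a k l ≡ 4 + n → shift 0 1 (P (3 + n)) k a ≡ signed k (lowerᵃ waring a k l)
  Y-part zero    _ = sym (signed-zero k)
  Y-part (suc a) e = P-coeff a k l (ℕ.suc-injective e)
  X-part : ∀ k → weight a k l ≡ 4 + n → ℚ.- shift 1 0 (P (2 + n)) k a ≡ signed k (lowerᵏ waring a k l)
  X-part zero    _ = refl
  X-part (suc k) e = begin
    ℚ.- P (2 + n) k a          ≡⟨ cong ℚ.-_ (P-coeff a k l (ℕ.suc-injective (ℕ.suc-injective (trans (sym (weight-sucᵏ a k l)) e)))) ⟩
    ℚ.- waringCoeff a k l      ≡⟨ signed-suc k (waring a k l) ⟨
    signed (suc k) (waring a k l) ∎
  one-part : ∀ l → weight a k l ≡ 4 + n → P (1 + n) k a ≡ signed k (lowerˡ waring a k l)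
  one-part zero    e = trans (P-vanishes (1 + n) k a ∄l) (sym (signed-zero k))
    where
    ∄l : ¬ (∃[ l ] weight a k l ≡ 1 + n)
    ∄l (l , e′) = ℕ.0≢1+n (weight-injectiveˡ a k (trans e (sym (trans (weight-sucˡ a k l) (cong (_+_ 3) e′)))))
  one-part (suc l) e = P-coeff a k l (ℕ.suc-injective (ℕ.suc-injective (ℕ.suc-injective (trans (sym (weight-sucˡ a k l)) e))))

P-rec-vanishes : ∀ n i j → ¬ (∃[ l ] weight j i l ≡ 4 + n) → newton-step P n i j ≡ 0ℚ
P-rec-vanishes n i j ∄l = cong₂ ℚ._+_ (cong₂ (λ y x → y ℚ.+ ℚ.- x) (Y-part j ∄l) (X-part i ∄l)) one-part
  where
  Y-part : ∀ j → ¬ (∃[ l ] weight j i l ≡ 4 + n) → shift 0 1 (P (3 + n)) i j ≡ 0ℚ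
  Y-part zero    _   = refl
  Y-part (suc j) ∄l′ = P-vanishes (3 + n) i j λ (l , e) → ∄l′ (l , cong suc e)
  X-part : ∀ i → ¬ (∃[ l ] weight j i l ≡ 4 + n) → shift 1 0 (P (2 + n)) i j ≡ 0ℚ
  X-part zero    _   = refl
  X-part (suc i) ∄l′ = P-vanishes (2 + n) i j λ (l , e) → ∄l′ (l , trans (weight-sucᵏ j i l) (cong (_+_ 2) e))
  one-part : P (1 + n) i j ≡ 0ℚ
  one-part = P-vanishes (1 + n) i j λ (l , e) → ∄l (suc l , trans (weight-sucˡ j i l) (cong (_+_ 3) e))

P-rec : ∀ n → P (4 + n) ≈ newton-step P n
P-rec n i j with weight≡? j i (4 + n)
... | yes (l , e) = trans (P-coeff j i l e) (sym (P-rec-coeff n j i l e))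
... | no ∄l       = trans (P-vanishes (4 + n) i j ∄l) (sym (P-rec-vanishes n i j ∄l))

Y*Y : (Yₚ *ₚ Yₚ) ≈ mono 1ℚ 0 2
Y*Y i j = trans (mono*ₚ 0 1 Yₚ i j) (shift-mono 1ℚ 0 1 1 i j)

Q₂-monomials : Q 2 ≈ -ₚ (mono 1ℚ 0 2 +ₚ (-ₚ (Xₚ +ₚ Xₚ)))
Q₂-monomials i j = cong (λ z → ℚ.- (z ℚ.+ ℚ.- (Xₚ i j ℚ.+ Xₚ i j))) (Y*Y i j)

Q₃-monomials : Q 3 ≈ -ₚ ((mono 1ℚ 0 3 +ₚ (-ₚ ((mono 1ℚ 1 1 +ₚ mono 1ℚ 1 1) +ₚ mono 1ℚ 1 1))) +ₚ ((1ₚ +ₚ 1ₚ) +ₚ 1ₚ))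
Q₃-monomials i j = cong₂ (λ y³ yx → ℚ.- (y³ ℚ.+ ℚ.- (yx ℚ.+ yx ℚ.+ yx) ℚ.+ (1ₚ i j ℚ.+ 1ₚ i j ℚ.+ 1ₚ i j))) Y*Y*Y Y*X
  where
  Y*Y*Y : ((Yₚ *ₚ Yₚ) *ₚ Yₚ) i j ≡ mono 1ℚ 0 3 i j
  Y*Y*Y = trans (*ₚ-congʳ Yₚ Y*Y i j) (trans (mono*ₚ 0 2 Yₚ i j) (shift-mono 1ℚ 0 2 1 i j))
  Y*X : (Yₚ *ₚ Xₚ) i j ≡ mono 1ℚ 1 1 i j
  Y*X = trans (mono*ₚ 0 1 Xₚ i j) (shift-mono 1ℚ 1 1 0 i j)

P₁≈Q₁ : P 1 ≈ Q 1
P₁≈Q₁ (suc i) j             = refl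
P₁≈Q₁ zero    zero          = refl
P₁≈Q₁ zero    (suc zero)    = refl
P₁≈Q₁ zero    (suc (suc j)) = refl

P₂≈Q₂ : P 2 ≈ Q 2
P₂≈Q₂ i j = trans (table i j) (sym (Q₂-monomials i j))
  where
  table : P 2 ≈ -ₚ (mono 1ℚ 0 2 +ₚ (-ₚ (Xₚ +ₚ Xₚ)))
  table (suc (suc i)) j                   = refl
  table (suc zero)    zero                = refl
  table (suc zero)    (suc j)             = refl
  table zero          zero                = refl
  table zero          (suc zero)          = refl
  table zero          (suc (suc zero))    = refl
  table zero          (suc (suc (suc j))) = refl

P₃≈Q₃ : P 3 ≈ Q 3
P₃≈Q₃ i j = trans (table i j) (sym (Q₃-monomials i j))
  where
  table : P 3 ≈ -ₚ ((mono 1ℚ 0 3 +ₚ (-ₚ ((mono 1ℚ 1 1 +ₚ mono 1ℚ 1 1) +ₚ mono 1ℚ 1 1))) +ₚ ((1ₚ +ₚ 1ₚ) +ₚ 1ₚ))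
  table (suc (suc i)) j                         = refl
  table (suc zero)    zero                      = refl
  table (suc zero)    (suc zero)                = refl
  table (suc zero)    (suc (suc j))             = refl
  table zero          zero                      = refl
  table zero          (suc zero)                = refl
  table zero          (suc (suc zero))          = refl
  table zero          (suc (suc (suc zero)))    = refl
  table zero          (suc (suc (suc (suc j)))) = refl

P≈Q : ∀ n → P (suc n) ≈ Q (suc n)
P≈Q 0 = P₁≈Q₁
P≈Q 1 = P₂≈Q₂
P≈Q 2 = P₃≈Q₃
P≈Q (suc (suc (suc n))) i j = begin
  P (4 + n) i j          ≡⟨ P-rec n i j ⟩
  newton-step P n i j    ≡⟨ newton-step-cong n {P} {Q} (P≈Q (suc (suc n))) (P≈Q (suc n)) (P≈Q n) i j ⟩
  newton-step Q n i j    ≡⟨ Q-rec n i j ⟨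
  Q (4 + n) i j          ∎

proposition2 : ∀ (d : ℕ) → 1 ≤ d → ∀ (i j : ℕ) → P d i j ≡ (-ₚ f Poly2-rawRing d Yₚ Xₚ 1ₚ) i j
proposition2 (suc n) _ = P≈Q n
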